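{- Let $p\in(0,1]$. Let $V$ be a set of $n$ distinct elements of a totally ordered set, and let the comparison costs $c_{(u,v)}$ of the unordered pairs be independent, each equal to $1$ with probability $p$ and to $\infty$ otherwise. Then the expected cost of the cheapest certificate for all maximal elements is $\Omega\left(n(1-(1-p)^{n-1})\right)$.
   Context: A comparison of cost $\infty$ is not allowed; only cost-1 comparisons can be performed. The cost-1 pairs, oriented according to the total order, generate (by transitivity) a partial order on $V$; an element is maximal if it is not below any other element in this partial order (in particular, an element with no cost-1 pair incident to it is maximal). A certificate for all maximal elements is a set of cost-1 comparisons from whose outcomes one can determine exactly which elements are maximal; its cost is its number of comparisons.
   Formalization: The probability $p$ takes only rational values in $(0,1]$. -}

module Defs where

open import Data.Nat as ℕ using (ℕ; zero; suc; _<ᵇ_)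
open import Data.Fin using (Fin; toℕ)
open import Data.List using (List; []; _∷_; [_]; _++_; map; concatMap; length; foldr; allFin)
open import Data.List.Membership.Propositional using (_∈_)
open import Data.Bool using (Bool; true; false; if_then_else_)
open import Data.Product using (_×_; _,_; Σ; ∃)
import Data.Rational as ℚ
open ℚ using (ℚ; 0ℚ; 1ℚ)
open import Relation.Nullary using (¬_)
open import Relation.Binary.Construct.Closure.Transitive using (TransClosure)
open import Function.Bundles using (_⇔_)
open import Function.Definitions using (Injective)
open import Relation.Binary.PropositionalEquality using (_≡_)

-- Vertex set V = Fin n.  A total order on V is given by an injective
-- rank function r : Fin n → ℕ  (u is below v iff r u < r v).

pairs : (n : ℕ) → List (Fin n × Fin n)
pairs n = concatMap (λ i → concatMap (λ j → if toℕ i <ᵇ toℕ j then [ (i , j) ] else [])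
                                      (allFin n))
                    (allFin n)


-- All bit lists of length m.  A cost assignment for V = Fin n is a bit list
-- b of length (length (pairs n)): true = cost 1, false = cost ∞.
allBits : ℕ → List (List Bool)
allBits zero    = [ [] ]
allBits (suc m) = map (true ∷_) (allBits m) ++ map (false ∷_) (allBits m)

select : {A : Set} → List A → List Bool → List A
select (x ∷ xs) (true  ∷ bs) = x ∷ select xs bs
select (x ∷ xs) (false ∷ bs) = select xs bs
select _        _            = []

cheapPairs : (n : ℕ) → List Bool → List (Fin n × Fin n)
cheapPairs n b = select (pairs n) b

ofℕ : ℕ → ℚ
ofℕ k = (Data.Integer.+ k) ℚ./ 1
  where import Data.Integer

pow : ℚ → ℕ → ℚ
pow x zero    = 1ℚ
pow x (suc k) = x ℚ.* pow x k

weight : ℚ → List Bool → ℚ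
weight p []            = 1ℚ
weight p (true  ∷ bs)  = p ℚ.* weight p bs
weight p (false ∷ bs)  = (1ℚ ℚ.- p) ℚ.* weight p bs

expect : (n : ℕ) → ℚ → (List Bool → ℕ) → ℚ
expect n p X = foldr (λ b acc → weight p b ℚ.* (ofℕ (X b)) ℚ.+ acc) 0ℚ
                     (allBits (length (pairs n)))


Step : {n : ℕ} → (Fin n → ℕ) → List (Fin n × Fin n) → Fin n → Fin n → Set
Step r E u v = (((u , v) ∈ E) Data.Sum.⊎ ((v , u) ∈ E)) × (r u ℕ.< r v)
  where import Data.Sum

Below : {n : ℕ} → (Fin n → ℕ) → List (Fin n × Fin n) → Fin n → Fin n → Set
Below r E = TransClosure (Step r E)

Maximal : {n : ℕ} → (Fin n → ℕ) → List (Fin n × Fin n) → Fin n → Set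
Maximal r E v = ∀ u → ¬ Below r E v u

SameOutcomes : {n : ℕ} → (Fin n → ℕ) → (Fin n → ℕ) → List (Fin n × Fin n) → Set
SameOutcomes r r' S = ∀ {i j} → (i , j) ∈ S →
  ((r i ℕ.< r j → r' i ℕ.< r' j) × (r j ℕ.< r i → r' j ℕ.< r' i))

Certificate : {n : ℕ} → (Fin n → ℕ) → List (Fin n × Fin n) → List (Fin n × Fin n) → Set
Certificate {n} r E S =
  (∀ {e} → e ∈ S → e ∈ E) ×
  ((r' : Fin n → ℕ) → Injective _≡_ _≡_ r' → SameOutcomes r r' S →
     ∀ v → (Maximal r E v ⇔ Maximal r' E v))

IsMinCertCost : {n : ℕ} → (Fin n → ℕ) → List (Fin n × Fin n) → ℕ → Set
IsMinCertCost r E k =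
  (Σ _ λ S → Certificate r E S × length S ≡ k) ×
  (∀ S → Certificate r E S → k ℕ.≤ length S)

{-# OPTIONS --safe #-}
module Submission where

-- A certificate must cover (contain a comparison at) every vertex v lying in a cost-1 pair:
-- if it avoided v, raising v to the top and lowering it to the bottom of the order would both
-- agree with every certified outcome, yet v is maximal after the first move and lies below its
-- cost-1 neighbour after the second.  A certificate with k comparisons covers at most 2k
-- vertices, so the cheapest one costs at least half the number of non-isolated vertices.  Each
-- vertex lies in n − 1 pairs, hence is non-isolated with probability 1 − (1 − p)^(n − 1), and
-- linearity of expectation gives the bound with c = 1/2.

open import Defs

module Counting where
  open import Algebra.Properties.CommutativeMonoid.Sum as Sum using ()
  open import Data.Bool using (Bool; true; false; not; _∧_; _∨_; T; if_then_else_)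
  open import Data.Fin using (Fin; zero; suc; toℕ)
  open import Data.Fin.Properties using (_≟_)
  open import Data.Bool.ListAction using (any)
  open import Data.List using (List; []; _∷_; [_]; _++_; tabulate; concatMap; allFin; length)
  open import Data.Nat using (ℕ; zero; suc; _+_; _*_; _∸_; _≤_; _<ᵇ_; z≤n)
  open import Data.Nat.Properties
    using (+-0-commutativeMonoid; +-assoc; +-identityʳ; +-mono-≤; +-monoʳ-≤; +-monoˡ-≤;
           ≤-refl; ≤-reflexive; ≤-trans; m≤m+n; m≤n+m; <ᵇ⇒<; <-irrefl; *-distribˡ-+; module ≤-Reasoning)
  open import Data.Product using (_×_; _,_)
  open import Function using (id; _∘_)
  open import Relation.Nullary using (¬_; yes; no; does; contradiction)
  open import Relation.Binary.PropositionalEquality using (_≡_; refl; sym; trans; cong; cong₂; module ≡-Reasoning)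

  open Sum +-0-commutativeMonoid using (sum; sum-syntax; sum-cong-≗; ∑-distrib-+; ∑-comm; sum-replicate-zero)

  𝟙 : Bool → ℕ
  𝟙 true  = 1
  𝟙 false = 0

  𝟙-∨-≤ : ∀ a b → 𝟙 (a ∨ b) ≤ 𝟙 a + 𝟙 b
  𝟙-∨-≤ true  b = m≤m+n 1 (𝟙 b)
  𝟙-∨-≤ false b = ≤-refl

  𝟙-mono : ∀ {a b} → (T a → T b) → 𝟙 a ≤ 𝟙 b
  𝟙-mono {false}        _   = z≤n
  𝟙-mono {true} {true}  _   = ≤-refl
  𝟙-mono {true} {false} a⇒b = contradiction _ a⇒b

  𝟙-∧-∨ : ∀ a b c → ¬ T (a ∧ b ∧ c) → 𝟙 (c ∧ (a ∨ b)) ≡ 𝟙 (a ∧ c) + 𝟙 (b ∧ c)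
  𝟙-∧-∨ true  true  true  ¬abc = contradiction _ ¬abc
  𝟙-∧-∨ true  true  false _    = refl
  𝟙-∧-∨ true  false true  _    = refl
  𝟙-∧-∨ true  false false _    = refl
  𝟙-∧-∨ false true  true  _    = refl
  𝟙-∧-∨ false true  false _    = refl
  𝟙-∧-∨ false false true  _    = refl
  𝟙-∧-∨ false false false _    = refl

  count : {A : Set} → (A → Bool) → List A → ℕ
  count Q []       = 0
  count Q (x ∷ xs) = 𝟙 (Q x) + count Q xs

  count-++ : {A : Set} (Q : A → Bool) (xs ys : List A) → count Q (xs ++ ys) ≡ count Q xs + count Q ys
  count-++ Q []       ys = refl
  count-++ Q (x ∷ xs) ys = trans (cong (𝟙 (Q x) +_) (count-++ Q xs ys)) (sym (+-assoc (𝟙 (Q x)) _ _))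

  count-concatMap-tabulate : {A B : Set} {n : ℕ} (Q : A → Bool) (f : B → List A) (g : Fin n → B) →
    count Q (concatMap f (tabulate g)) ≡ ∑[ i < n ] count Q (f (g i))
  count-concatMap-tabulate {n = zero}  Q f g = refl
  count-concatMap-tabulate {n = suc n} Q f g =
    trans (count-++ Q (f (g zero)) _) (cong (count Q (f (g zero)) +_) (count-concatMap-tabulate Q f (g ∘ suc)))

  count-if : {A : Set} (Q : A → Bool) (c : Bool) (x : A) → count Q (if c then [ x ] else []) ≡ 𝟙 (c ∧ Q x)
  count-if Q true  x = +-identityʳ (𝟙 (Q x))
  count-if Q false x = refl

  ∑-mono-≤ : ∀ {n} {f g : Fin n → ℕ} → (∀ x → f x ≤ g x) → sum f ≤ sum g
  ∑-mono-≤ {zero}  f≤g = ≤-refl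
  ∑-mono-≤ {suc n} f≤g = +-mono-≤ (f≤g zero) (∑-mono-≤ (f≤g ∘ suc))

  term≤sum : ∀ {n} (f : Fin n → ℕ) x → f x ≤ sum f
  term≤sum f zero    = m≤m+n (f zero) _
  term≤sum f (suc x) = ≤-trans (term≤sum (f ∘ suc) x) (m≤n+m _ (f zero))

  ∑-1 : ∀ n → ∑[ x < n ] 1 ≡ n
  ∑-1 zero    = refl
  ∑-1 (suc n) = cong suc (∑-1 n)

  ∑-pick : ∀ {n} (v : Fin n) (f : Fin n → Bool) → ∑[ x < n ] 𝟙 (does (x ≟ v) ∧ f x) ≡ 𝟙 (f v)
  ∑-pick {suc n} zero    f = trans (cong (𝟙 (f zero) +_) (sum-replicate-zero n)) (+-identityʳ _)
  ∑-pick {suc n} (suc v) f = ∑-pick v (f ∘ suc)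

  ∑-≟ : ∀ {n} (v : Fin n) → ∑[ x < n ] 𝟙 (does (v ≟ x)) ≡ 1
  ∑-≟ {suc n} zero    = cong suc (sum-replicate-zero n)
  ∑-≟ {suc n} (suc v) = ∑-≟ v

  ∑-≢ : ∀ {n} (v : Fin n) → ∑[ x < n ] 𝟙 (not (does (x ≟ v))) ≡ n ∸ 1
  ∑-≢ {suc n} zero    = ∑-1 n
  ∑-≢ {suc (suc n)} (suc v) = cong suc (∑-≢ v)

  𝟙-<ᵇ-trichotomy : ∀ {n} (v x : Fin n) → 𝟙 (toℕ v <ᵇ toℕ x) + 𝟙 (toℕ x <ᵇ toℕ v) ≡ 𝟙 (not (does (x ≟ v)))
  𝟙-<ᵇ-trichotomy zero    zero    = refl
  𝟙-<ᵇ-trichotomy zero    (suc x) = refl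
  𝟙-<ᵇ-trichotomy (suc v) zero    = refl
  𝟙-<ᵇ-trichotomy (suc v) (suc x) = 𝟙-<ᵇ-trichotomy v x

  incident : ∀ {n} → Fin n → Fin n × Fin n → Bool
  incident v (i , j) = does (i ≟ v) ∨ does (j ≟ v)

  covers : ∀ {n} → List (Fin n × Fin n) → Fin n → Bool
  covers E v = any (incident v) E

  count-pairs : ∀ {n} (Q : Fin n × Fin n → Bool) →
    count Q (pairs n) ≡ ∑[ i < n ] ∑[ j < n ] 𝟙 ((toℕ i <ᵇ toℕ j) ∧ Q (i , j))
  count-pairs {n} Q = begin
    count Q (pairs n)                                  ≡⟨ count-concatMap-tabulate Q row id ⟩
    ∑[ i < n ] count Q (row i)                         ≡⟨ sum-cong-≗ {n} (λ i → count-concatMap-tabulate Q (cell i) id) ⟩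
    ∑[ i < n ] ∑[ j < n ] count Q (cell i j)           ≡⟨ sum-cong-≗ {n} (λ i → sum-cong-≗ {n} (λ j → count-if Q _ (i , j))) ⟩
    ∑[ i < n ] ∑[ j < n ] 𝟙 ((toℕ i <ᵇ toℕ j) ∧ Q (i , j)) ∎
    where
    open ≡-Reasoning
    cell : Fin n → Fin n → List (Fin n × Fin n)
    cell i j = if toℕ i <ᵇ toℕ j then [ (i , j) ] else []
    row : Fin n → List (Fin n × Fin n)
    row i = concatMap (cell i) (allFin n)

  no-loop : ∀ {n} (i j v : Fin n) → ¬ T (does (i ≟ v) ∧ does (j ≟ v) ∧ (toℕ i <ᵇ toℕ j))
  no-loop i j v with i ≟ v | j ≟ v
  ... | yes refl | yes refl = λ v<v → <-irrefl refl (<ᵇ⇒< (toℕ v) (toℕ v) v<v)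
  ... | yes _    | no _     = λ ()
  ... | no _     | _        = λ ()

  count-incident-pairs-split : ∀ {n} (v : Fin n) →
    count (incident v) (pairs n) ≡ ∑[ j < n ] 𝟙 (toℕ v <ᵇ toℕ j) + ∑[ i < n ] 𝟙 (toℕ i <ᵇ toℕ v)
  count-incident-pairs-split {n} v = begin
    count (incident v) (pairs n)
      ≡⟨ count-pairs (incident v) ⟩
    ∑[ i < n ] ∑[ j < n ] 𝟙 ((toℕ i <ᵇ toℕ j) ∧ incident v (i , j))
      ≡⟨ sum-cong-≗ {n} (λ i → sum-cong-≗ {n} (λ j → 𝟙-∧-∨ (does (i ≟ v)) (does (j ≟ v)) (toℕ i <ᵇ toℕ j) (no-loop i j v))) ⟩
    ∑[ i < n ] ∑[ j < n ] (starts i j + ends i j)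
      ≡⟨ sum-cong-≗ {n} (λ i → ∑-distrib-+ {n} (starts i) (ends i)) ⟩
    ∑[ i < n ] (sum (starts i) + sum (ends i))
      ≡⟨ ∑-distrib-+ {n} (sum ∘ starts) (sum ∘ ends) ⟩
    ∑[ i < n ] sum (starts i) + ∑[ i < n ] sum (ends i)
      ≡⟨ cong₂ _+_ (trans (∑-comm {n} {n} starts) (sum-cong-≗ {n} (λ j → ∑-pick v (λ i → toℕ i <ᵇ toℕ j))))
                   (sum-cong-≗ {n} (λ i → ∑-pick v (λ j → toℕ i <ᵇ toℕ j))) ⟩
    ∑[ j < n ] 𝟙 (toℕ v <ᵇ toℕ j) + ∑[ i < n ] 𝟙 (toℕ i <ᵇ toℕ v) ∎
    where
    open ≡-Reasoning
    starts ends : Fin n → Fin n → ℕ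
    starts i j = 𝟙 (does (i ≟ v) ∧ (toℕ i <ᵇ toℕ j))
    ends   i j = 𝟙 (does (j ≟ v) ∧ (toℕ i <ᵇ toℕ j))

  count-incident-pairs : ∀ {n} (v : Fin n) → count (incident v) (pairs n) ≡ n ∸ 1
  count-incident-pairs {n} v = begin
    count (incident v) (pairs n)
      ≡⟨ count-incident-pairs-split v ⟩
    ∑[ j < n ] 𝟙 (toℕ v <ᵇ toℕ j) + ∑[ j < n ] 𝟙 (toℕ j <ᵇ toℕ v)
      ≡⟨ ∑-distrib-+ {n} (λ j → 𝟙 (toℕ v <ᵇ toℕ j)) (λ j → 𝟙 (toℕ j <ᵇ toℕ v)) ⟨
    ∑[ j < n ] (𝟙 (toℕ v <ᵇ toℕ j) + 𝟙 (toℕ j <ᵇ toℕ v))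
      ≡⟨ sum-cong-≗ {n} (𝟙-<ᵇ-trichotomy v) ⟩
    ∑[ j < n ] 𝟙 (not (does (j ≟ v)))
      ≡⟨ ∑-≢ v ⟩
    n ∸ 1 ∎
    where open ≡-Reasoning

  ∑-covers-≤ : ∀ {n} (S : List (Fin n × Fin n)) → ∑[ v < n ] 𝟙 (covers S v) ≤ 2 * length S
  ∑-covers-≤ {n} []            = ≤-reflexive (sum-replicate-zero n)
  ∑-covers-≤ {n} ((i , j) ∷ S) = begin
    ∑[ v < n ] 𝟙 (incident v (i , j) ∨ covers S v)
      ≤⟨ ∑-mono-≤ (λ v → ≤-trans (𝟙-∨-≤ (incident v (i , j)) _) (+-monoˡ-≤ _ (𝟙-∨-≤ (does (i ≟ v)) _))) ⟩
    ∑[ v < n ] (𝟙 (does (i ≟ v)) + 𝟙 (does (j ≟ v)) + 𝟙 (covers S v))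
      ≡⟨ trans (∑-distrib-+ {n} (λ v → 𝟙 (does (i ≟ v)) + 𝟙 (does (j ≟ v))) (λ v → 𝟙 (covers S v)))
               (cong (_+ covered) (∑-distrib-+ {n} (λ v → 𝟙 (does (i ≟ v))) (λ v → 𝟙 (does (j ≟ v))))) ⟩
    ∑[ v < n ] 𝟙 (does (i ≟ v)) + ∑[ v < n ] 𝟙 (does (j ≟ v)) + ∑[ v < n ] 𝟙 (covers S v)
      ≡⟨ cong (_+ covered) (cong₂ _+_ (∑-≟ i) (∑-≟ j)) ⟩
    2 + ∑[ v < n ] 𝟙 (covers S v)
      ≤⟨ +-monoʳ-≤ 2 (∑-covers-≤ S) ⟩
    2 + 2 * length S
      ≡⟨ *-distribˡ-+ 2 1 (length S) ⟨
    2 * length ((i , j) ∷ S) ∎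
    where
    open ≤-Reasoning
    covered : ℕ
    covered = ∑[ v < n ] 𝟙 (covers S v)

module Certificates where
  open Counting
  open import Algebra.Properties.CommutativeMonoid.Sum as Sum using ()
  open import Data.Bool using (T)
  open import Data.Bool.Properties using (T?)
  open import Data.Fin using (Fin)
  open import Data.Fin.Properties using (_≟_)
  open import Data.List using (List)
  open import Data.List.Membership.Propositional using (_∈_; lose; find)
  open import Data.List.Relation.Unary.Any.Properties using (any⁺; any⁻)
  open import Data.Nat using (ℕ; suc; _<_; _≤_; z<s; s<s)
  open import Data.Nat.Properties using (+-0-commutativeMonoid; <⇒≢; <⇒≱; ≤-refl; ≤-trans; n≤1+n; suc-injective)
  open import Data.Product using (_×_; _,_; ∃)
  open import Data.Sum using (_⊎_; inj₁; inj₂)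
  open import Data.Vec.Functional using (updateAt)
  open import Data.Vec.Functional.Properties using (updateAt-updates; updateAt-minimal)
  open import Function using (id; const; _∘_)
  open import Function.Bundles using (Equivalence)
  open import Function.Definitions using (Injective)
  open import Relation.Binary.Construct.Closure.Transitive using ([_]; _∷_)
  open import Relation.Binary.PropositionalEquality using (_≡_; _≢_; refl; sym; trans; subst₂)
  open import Relation.Nullary using (¬_; yes; no; contradiction)

  open Sum +-0-commutativeMonoid using (sum)

  module _ {n : ℕ} where

    Avoids : List (Fin n × Fin n) → Fin n → Set
    Avoids S v = ∀ {i j} → (i , j) ∈ S → i ≢ v × j ≢ v

    Loopless : List (Fin n × Fin n) → Set
    Loopless E = ∀ {i j} → (i , j) ∈ E → i ≢ j

    incident⇒endpoint : ∀ {v i j : Fin n} → T (incident v (i , j)) → i ≡ v ⊎ j ≡ v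
    incident⇒endpoint {v} {i} {j} with i ≟ v | j ≟ v
    ... | yes i≡v | _       = λ _ → inj₁ i≡v
    ... | no _    | yes j≡v = λ _ → inj₂ j≡v
    ... | no _    | no _    = λ ()

    endpoint⇒incident : ∀ {v i j : Fin n} → i ≡ v ⊎ j ≡ v → T (incident v (i , j))
    endpoint⇒incident {v} {i} {j} with i ≟ v | j ≟ v
    ... | yes _   | _     = λ _ → _
    ... | no _    | yes _ = λ _ → _
    ... | no i≢v  | no j≢v = λ { (inj₁ i≡v) → i≢v i≡v ; (inj₂ j≡v) → j≢v j≡v }

    ¬covers⇒avoids : ∀ {S v} → ¬ T (covers S v) → Avoids S v
    ¬covers⇒avoids {v = v} ¬cov {i} {j} e∈S =
        (λ i≡v → ¬cov (any⁺ _ (lose e∈S (endpoint⇒incident {v} {i} {j} (inj₁ i≡v)))))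
      , (λ j≡v → ¬cov (any⁺ _ (lose e∈S (endpoint⇒incident {v} {i} {j} (inj₂ j≡v)))))

    covers⇒neighbour : ∀ {E v} → Loopless E → T (covers E v) →
                       ∃ λ u → u ≢ v × ((v , u) ∈ E ⊎ (u , v) ∈ E)
    covers⇒neighbour {E} {v} loopless cov with find (any⁻ _ E cov)
    ... | (i , j) , e∈E , inc with incident⇒endpoint {v} {i} {j} inc
    ... | inj₁ refl = j , (λ j≡v → loopless e∈E (sym j≡v)) , inj₁ e∈E
    ... | inj₂ refl = i , loopless e∈E , inj₂ e∈E

    sameOutcomes-away : ∀ {r r′ : Fin n → ℕ} {S v} (f : ℕ → ℕ) → (∀ {a b} → a < b → f a < f b) →
                        (∀ x → x ≢ v → r′ x ≡ f (r x)) → Avoids S v → SameOutcomes r r′ S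
    sameOutcomes-away {r} {r′} {v = v} f f-mono r′≡f∘r avoids e∈S =
      let i≢v , j≢v = avoids e∈S in move i≢v j≢v , move j≢v i≢v
      where
      move : ∀ {x y} → x ≢ v → y ≢ v → r x < r y → r′ x < r′ y
      move x≢v y≢v rx<ry = subst₂ _<_ (sym (r′≡f∘r _ x≢v)) (sym (r′≡f∘r _ y≢v)) (f-mono rx<ry)

    updateAt-injective : ∀ {r : Fin n → ℕ} {v k} → Injective _≡_ _≡_ r → (∀ x → x ≢ v → r x ≢ k) →
                         Injective _≡_ _≡_ (updateAt r v (const k))
    updateAt-injective {r} {v} inj fresh {x} {y} eq with x ≟ v | y ≟ v
    ... | yes refl | yes refl = refl
    ... | yes refl | no y≢v   =
      contradiction (trans (sym (updateAt-minimal y v r y≢v)) (trans (sym eq) (updateAt-updates v r))) (fresh y y≢v)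
    ... | no x≢v   | yes refl =
      contradiction (trans (sym (updateAt-minimal x v r x≢v)) (trans eq (updateAt-updates v r))) (fresh x x≢v)
    ... | no x≢v   | no y≢v   =
      inj (trans (sym (updateAt-minimal x v r x≢v)) (trans eq (updateAt-minimal y v r y≢v)))

    raise lower : (Fin n → ℕ) → Fin n → Fin n → ℕ
    raise r v = updateAt r v (const (suc (sum r)))
    lower r v = updateAt (suc ∘ r) v (const 0)

    raise-injective : ∀ {r} v → Injective _≡_ _≡_ r → Injective _≡_ _≡_ (raise r v)
    raise-injective {r} v inj = updateAt-injective inj (λ x _ → <⇒≢ (s<s (term≤sum r x)))

    lower-injective : ∀ {r} v → Injective _≡_ _≡_ r → Injective _≡_ _≡_ (lower r v)
    lower-injective v inj = updateAt-injective (inj ∘ suc-injective) (λ _ _ ())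

    lower-bottom : ∀ r {u v} → u ≢ v → lower r v v < lower r v u
    lower-bottom r {u} {v} u≢v =
      subst₂ _<_ (sym (updateAt-updates v (suc ∘ r))) (sym (updateAt-minimal u v (suc ∘ r) u≢v)) z<s

    raise-top : ∀ r v u → raise r v u ≤ raise r v v
    raise-top r v u with u ≟ v
    ... | yes refl = ≤-refl
    ... | no u≢v   = subst₂ _≤_ (sym (updateAt-minimal u v r u≢v)) (sym (updateAt-updates v r))
                              (≤-trans (term≤sum r u) (n≤1+n _))

    top-maximal : ∀ {r : Fin n → ℕ} {E v} → (∀ u → r u ≤ r v) → Maximal r E v
    top-maximal top u [ _ , v<u ]     = <⇒≱ v<u (top u)
    top-maximal top u ((_ , v<w) ∷ _) = <⇒≱ v<w (top _)

    certificate-covers : ∀ {r : Fin n → ℕ} {E S v} → Injective _≡_ _≡_ r → Loopless E →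
                         Certificate r E S → T (covers E v) → T (covers S v)
    certificate-covers {r} {E} {S} {v} inj loopless (_ , sameMaxima) cov with T? (covers S v)
    ... | yes covS = covS
    ... | no ¬covS = contradiction maximal-in-r ¬maximal-in-r
      where
      avoids : Avoids S v
      avoids = ¬covers⇒avoids ¬covS

      maximal-in-r : Maximal r E v
      maximal-in-r = Equivalence.from (sameMaxima (raise r v) (raise-injective v inj)
                       (sameOutcomes-away id id (λ x x≢v → updateAt-minimal x v r x≢v) avoids) v)
                       (top-maximal (raise-top r v))

      ¬maximal-in-r : ¬ Maximal r E v
      ¬maximal-in-r maximal with covers⇒neighbour loopless cov
      ... | u , u≢v , edge = Equivalence.to (sameMaxima (lower r v) (lower-injective v inj)
                               (sameOutcomes-away suc s<s (λ x x≢v → updateAt-minimal x v (suc ∘ r) x≢v) avoids) v)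
                               maximal u [ edge , lower-bottom r u≢v ]

module Expectation where
  open Counting using (𝟙; count)
  open import Algebra.Properties.CommutativeMonoid.Sum as Sum using ()
  open import Data.Bool using (Bool; true; false; _∨_)
  open import Data.Bool.ListAction using (any)
  open import Data.Fin using (Fin; zero; suc)
  import Data.Integer as ℤ
  import Data.Integer.Properties as ℤ
  import Data.Integer.Tactic.RingSolver as ℤ-Solver
  open import Data.List using (List; []; _∷_; _++_; map; foldr; length)
  open import Data.List.Membership.Propositional using (_∈_)
  open import Data.List.Relation.Unary.Any using (here; there)
  import Data.Nat as ℕ
  open import Data.Nat using (ℕ; zero; suc)
  import Data.Nat.Properties as ℕ
  open import Data.Rational using (ℚ; 0ℚ; 1ℚ; _+_; _*_; _-_; -_; _≤_; nonNegative; toℚᵘ)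
  open import Data.Rational.Properties
  import Data.Rational.Unnormalised as ℚᵘ
  import Data.Rational.Unnormalised.Properties as ℚᵘ
  open import Function using (_∘_)
  open import Relation.Binary.PropositionalEquality using (_≡_; refl; sym; trans; cong; cong₂; subst; module ≡-Reasoning)
  open import Relation.Nullary.Decidable using (dec⇒maybe)
  open import Tactic.RingSolver using (solve-∀)
  open import Tactic.RingSolver.Core.AlmostCommutativeRing using (AlmostCommutativeRing; fromCommutativeRing)

  open Sum ℕ.+-0-commutativeMonoid using (sum-syntax)

  ℚ-ring : AlmostCommutativeRing _ _
  ℚ-ring = fromCommutativeRing +-*-commutativeRing (λ x → dec⇒maybe (0ℚ ≟ x))

  ofℕ-+ : ∀ a b → ofℕ (a ℕ.+ b) ≡ ofℕ a + ofℕ b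
  ofℕ-+ a b = toℚᵘ-injective (begin
    toℚᵘ (ofℕ (a ℕ.+ b))             ≈⟨ toℚᵘ-fromℚᵘ (integer (a ℕ.+ b)) ⟩
    integer (a ℕ.+ b)                ≈⟨ ℚᵘ.*≡* (trans (cong (ℤ._* ℤ.1ℤ) (ℤ.pos-+ a b)) (ℤ-distrib (ℤ.+ a) (ℤ.+ b))) ⟩
    integer a ℚᵘ.+ integer b         ≈⟨ ℚᵘ.+-cong (toℚᵘ-fromℚᵘ (integer a)) (toℚᵘ-fromℚᵘ (integer b)) ⟨
    toℚᵘ (ofℕ a) ℚᵘ.+ toℚᵘ (ofℕ b)   ≈⟨ toℚᵘ-homo-+ (ofℕ a) (ofℕ b) ⟨
    toℚᵘ (ofℕ a + ofℕ b)             ∎)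
    where
    open ℚᵘ.≃-Reasoning
    integer : ℕ → ℚᵘ.ℚᵘ
    integer k = ℚᵘ.mkℚᵘ (ℤ.+ k) 0
    ℤ-distrib : ∀ x y → (x ℤ.+ y) ℤ.* ℤ.1ℤ ≡ (x ℤ.* ℤ.1ℤ ℤ.+ y ℤ.* ℤ.1ℤ) ℤ.* ℤ.1ℤ
    ℤ-distrib = ℤ-Solver.solve-∀

  ofℕ-nonNeg : ∀ a → 0ℚ ≤ ofℕ a
  ofℕ-nonNeg a = nonNegative⁻¹ (ofℕ a) {{normalize-nonNeg a 1}}

  ofℕ-mono : ∀ {a b} → a ℕ.≤ b → ofℕ a ≤ ofℕ b
  ofℕ-mono {a} {b} a≤b = begin
    ofℕ a                    ≡⟨ +-identityʳ (ofℕ a) ⟨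
    ofℕ a + 0ℚ               ≤⟨ +-monoʳ-≤ (ofℕ a) (ofℕ-nonNeg (b ℕ.∸ a)) ⟩
    ofℕ a + ofℕ (b ℕ.∸ a)    ≡⟨ ofℕ-+ a (b ℕ.∸ a) ⟨
    ofℕ (a ℕ.+ (b ℕ.∸ a))    ≡⟨ cong ofℕ (ℕ.m+[n∸m]≡n a≤b) ⟩
    ofℕ b                    ∎
    where open ≤-Reasoning

  p≤1⇒0≤1-p : ∀ {p} → p ≤ 1ℚ → 0ℚ ≤ 1ℚ - p
  p≤1⇒0≤1-p {p} p≤1 = subst (_≤ 1ℚ - p) (+-inverseʳ p) (+-monoˡ-≤ (- p) p≤1)

  nonNeg*nonNeg : ∀ {x y} → 0ℚ ≤ x → 0ℚ ≤ y → 0ℚ ≤ x * y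
  nonNeg*nonNeg {x} {y} 0≤x 0≤y =
    nonNegative⁻¹ (x * y) {{nonNeg*nonNeg⇒nonNeg x {{nonNegative 0≤x}} y {{nonNegative 0≤y}}}}

  convex : ∀ p x → p * x + (1ℚ - p) * x ≡ x
  convex = solve-∀ ℚ-ring

  module _ (p : ℚ) where

    bitWeight : Bool → ℚ
    bitWeight true  = p
    bitWeight false = 1ℚ - p

    weight-∷ : ∀ t bs → weight p (t ∷ bs) ≡ bitWeight t * weight p bs
    weight-∷ true  bs = refl
    weight-∷ false bs = refl

    weightedSum : List (List Bool) → (List Bool → ℚ) → ℚ
    weightedSum A f = foldr (λ b acc → weight p b * f b + acc) 0ℚ A

    𝔼 : ℕ → (List Bool → ℚ) → ℚ
    𝔼 m = weightedSum (allBits m)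

    weightedSum-++ : ∀ A B f → weightedSum (A ++ B) f ≡ weightedSum A f + weightedSum B f
    weightedSum-++ []      B f = sym (+-identityˡ _)
    weightedSum-++ (b ∷ A) B f =
      trans (cong (weight p b * f b +_) (weightedSum-++ A B f)) (sym (+-assoc (weight p b * f b) _ _))

    weightedSum-map-∷ : ∀ t A f → weightedSum (map (t ∷_) A) f ≡ bitWeight t * weightedSum A (f ∘ (t ∷_))
    weightedSum-map-∷ t []      f = sym (*-zeroʳ (bitWeight t))
    weightedSum-map-∷ t (b ∷ A) f = begin
      weight p (t ∷ b) * f (t ∷ b) + weightedSum (map (t ∷_) A) f
        ≡⟨ cong₂ _+_ (cong (_* f (t ∷ b)) (weight-∷ t b)) (weightedSum-map-∷ t A f) ⟩
      bitWeight t * weight p b * f (t ∷ b) + bitWeight t * weightedSum A (f ∘ (t ∷_))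
        ≡⟨ factor (bitWeight t) (weight p b) (f (t ∷ b)) _ ⟩
      bitWeight t * (weight p b * f (t ∷ b) + weightedSum A (f ∘ (t ∷_))) ∎
      where
      open ≡-Reasoning
      factor : ∀ w x y z → w * x * y + w * z ≡ w * (x * y + z)
      factor = solve-∀ ℚ-ring

    𝔼-suc : ∀ m f → 𝔼 (suc m) f ≡ p * 𝔼 m (f ∘ (true ∷_)) + (1ℚ - p) * 𝔼 m (f ∘ (false ∷_))
    𝔼-suc m f = trans (weightedSum-++ (map (true ∷_) (allBits m)) _ f)
                      (cong₂ _+_ (weightedSum-map-∷ true (allBits m) f) (weightedSum-map-∷ false (allBits m) f))

    weightedSum-cong : ∀ A {f g} → (∀ b → f b ≡ g b) → weightedSum A f ≡ weightedSum A g
    weightedSum-cong []      f≡g = refl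
    weightedSum-cong (b ∷ A) f≡g = cong₂ _+_ (cong (weight p b *_) (f≡g b)) (weightedSum-cong A f≡g)

    weightedSum-+ : ∀ A f g → weightedSum A (λ b → f b + g b) ≡ weightedSum A f + weightedSum A g
    weightedSum-+ []      f g = sym (+-identityˡ 0ℚ)
    weightedSum-+ (b ∷ A) f g =
      trans (cong (weight p b * (f b + g b) +_) (weightedSum-+ A f g)) (regroup (weight p b) (f b) (g b) _ _)
      where
      regroup : ∀ w x y z u → w * (x + y) + (z + u) ≡ (w * x + z) + (w * y + u)
      regroup = solve-∀ ℚ-ring

    weightedSum-0 : ∀ A → weightedSum A (λ _ → 0ℚ) ≡ 0ℚ
    weightedSum-0 []      = refl
    weightedSum-0 (b ∷ A) = cong₂ _+_ (*-zeroʳ (weight p b)) (weightedSum-0 A)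

    𝔼-1 : ∀ m → 𝔼 m (λ _ → 1ℚ) ≡ 1ℚ
    𝔼-1 zero    = *-identityʳ 1ℚ
    𝔼-1 (suc m) = trans (𝔼-suc m _) (trans (cong₂ (λ x y → p * x + (1ℚ - p) * y) (𝔼-1 m) (𝔼-1 m)) (convex p 1ℚ))

    𝔼-any-select : {A : Set} (Q : A → Bool) (L : List A) →
      𝔼 (length L) (λ b → ofℕ (𝟙 (any Q (select L b)))) ≡ 1ℚ - pow (1ℚ - p) (count Q L)
    𝔼-any-select Q []       = refl
    𝔼-any-select Q (x ∷ xs) = trans (𝔼-suc (length xs) _) (by-first (Q x))
      where
      hit : List Bool → ℚ
      hit b = ofℕ (𝟙 (any Q (select xs b)))
      escape : ∀ q y → q * 1ℚ + (1ℚ - q) * (1ℚ - y) ≡ 1ℚ - (1ℚ - q) * y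
      escape = solve-∀ ℚ-ring
      by-first : ∀ c → p * 𝔼 (length xs) (λ b → ofℕ (𝟙 (c ∨ any Q (select xs b)))) + (1ℚ - p) * 𝔼 (length xs) hit
                       ≡ 1ℚ - pow (1ℚ - p) (𝟙 c ℕ.+ count Q xs)
      by-first true  = trans (cong₂ (λ x y → p * x + (1ℚ - p) * y) (𝔼-1 (length xs)) (𝔼-any-select Q xs))
                             (escape p (pow (1ℚ - p) (count Q xs)))
      by-first false = trans (cong₂ (λ x y → p * x + (1ℚ - p) * y) (𝔼-any-select Q xs) (𝔼-any-select Q xs))
                             (convex p _)

    weightedSum-∑ : ∀ A {n} (h : Fin n → List Bool → ℕ) {X} → (∀ v → weightedSum A (ofℕ ∘ h v) ≡ X) →
                    weightedSum A (λ b → ofℕ (∑[ v < n ] h v b)) ≡ ofℕ n * X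
    weightedSum-∑ A {zero}  h {X} _   = trans (weightedSum-0 A) (sym (*-zeroˡ X))
    weightedSum-∑ A {suc n} h {X} h≡X = begin
      weightedSum A (λ b → ofℕ (h zero b ℕ.+ ∑[ v < n ] h (suc v) b))
        ≡⟨ weightedSum-cong A (λ b → ofℕ-+ (h zero b) _) ⟩
      weightedSum A (λ b → ofℕ (h zero b) + ofℕ (∑[ v < n ] h (suc v) b))
        ≡⟨ weightedSum-+ A _ _ ⟩
      weightedSum A (ofℕ ∘ h zero) + weightedSum A (λ b → ofℕ (∑[ v < n ] h (suc v) b))
        ≡⟨ cong₂ _+_ (h≡X zero) (weightedSum-∑ A (h ∘ suc) (h≡X ∘ suc)) ⟩
      X + ofℕ n * X
        ≡⟨ one-more X (ofℕ n) ⟩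
      (1ℚ + ofℕ n) * X
        ≡⟨ cong (_* X) (ofℕ-+ 1 n) ⟨
      ofℕ (suc n) * X ∎
      where
      open ≡-Reasoning
      one-more : ∀ x y → x + y * x ≡ (1ℚ + y) * x
      one-more = solve-∀ ℚ-ring

    weight-nonNeg : 0ℚ ≤ p → p ≤ 1ℚ → ∀ bs → 0ℚ ≤ weight p bs
    weight-nonNeg 0≤p p≤1 []           = nonNegative⁻¹ 1ℚ
    weight-nonNeg 0≤p p≤1 (true  ∷ bs) = nonNeg*nonNeg 0≤p (weight-nonNeg 0≤p p≤1 bs)
    weight-nonNeg 0≤p p≤1 (false ∷ bs) = nonNeg*nonNeg (p≤1⇒0≤1-p p≤1) (weight-nonNeg 0≤p p≤1 bs)

    weightedSum-mono : 0ℚ ≤ p → p ≤ 1ℚ → ∀ A {f g} → (∀ b → b ∈ A → f b ≤ g b) → weightedSum A f ≤ weightedSum A g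
    weightedSum-mono 0≤p p≤1 []      f≤g = ≤-refl
    weightedSum-mono 0≤p p≤1 (b ∷ A) f≤g =
      +-mono-≤ (*-monoˡ-≤-nonNeg (weight p b) {{nonNegative (weight-nonNeg 0≤p p≤1 b)}} (f≤g b (here refl)))
               (weightedSum-mono 0≤p p≤1 A (λ b′ b′∈A → f≤g b′ (there b′∈A)))

open import Data.Nat using (ℕ; _≤_; _∸_)
open import Data.Fin using (Fin)
open import Data.List using (List; length)
open import Data.List.Membership.Propositional using (_∈_)
open import Data.Bool using (Bool)
open import Data.Product using (Σ; _×_)
open import Data.Rational using (ℚ; 0ℚ; 1ℚ; _<_; _*_; _-_) renaming (_≤_ to _≤ℚ_)
open import Function.Definitions using (Injective)
open import Relation.Binary.PropositionalEquality using (_≡_)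

open Counting
open Certificates
open Expectation
open import Algebra.Properties.CommutativeMonoid.Sum as Sum using ()
open import Data.Bool using (true; false; T; if_then_else_)
open import Data.Fin using (toℕ)
open import Data.List using ([]; _∷_; [_]; allFin)
open import Data.List.Membership.Propositional using (find)
open import Data.List.Membership.Propositional.Properties using (∈-concatMap⁻)
open import Data.List.Relation.Unary.Any using (here; there)
import Data.Nat as ℕ
import Data.Nat.Properties as ℕ
open import Data.Product using (_,_)
open import Data.Rational using (½; _+_)
open import Data.Rational.Properties using (*-assoc; *-monoˡ-≤-nonNeg; <⇒≤; positive⁻¹; module ≤-Reasoning)
open import Function using (_∘_)
open import Relation.Binary.PropositionalEquality using (refl; trans; cong; subst; module ≡-Reasoning)
open import Tactic.RingSolver using (solve-∀)

open Sum ℕ.+-0-commutativeMonoid using (sum-syntax)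

select-⊆ : {A : Set} (L : List A) (bs : List Bool) {x : A} → x ∈ select L bs → x ∈ L
select-⊆ (y ∷ L) (true  ∷ bs) (here x≡y)  = here x≡y
select-⊆ (y ∷ L) (true  ∷ bs) (there x∈) = there (select-⊆ L bs x∈)
select-⊆ (y ∷ L) (false ∷ bs) x∈         = there (select-⊆ L bs x∈)

∈-if-singleton : {A : Set} {x y : A} (c : Bool) → x ∈ (if c then [ y ] else []) → T c × x ≡ y
∈-if-singleton true (here x≡y) = _ , x≡y

∈-pairs⇒< : ∀ {n} {i j : Fin n} → (i , j) ∈ pairs n → toℕ i ℕ.< toℕ j
∈-pairs⇒< {n} e∈ with find (∈-concatMap⁻ _ {xs = allFin n} e∈)
... | i′ , _ , e∈row with find (∈-concatMap⁻ _ {xs = allFin n} e∈row)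
... | j′ , _ , e∈cell with ∈-if-singleton (toℕ i′ ℕ.<ᵇ toℕ j′) e∈cell
... | i′<j′ , refl = ℕ.<ᵇ⇒< (toℕ i′) (toℕ j′) i′<j′

cheapPairs-loopless : ∀ n b → Loopless (cheapPairs n b)
cheapPairs-loopless n b e∈ refl = ℕ.<-irrefl refl (∈-pairs⇒< (select-⊆ (pairs n) b e∈))

coveredCount : ∀ n → List Bool → ℕ
coveredCount n b = ∑[ v < n ] 𝟙 (covers (cheapPairs n b) v)

coveredCount≤2*cost : ∀ {n} {r : Fin n → ℕ} {b S} → Injective _≡_ _≡_ r →
                      Certificate r (cheapPairs n b) S → coveredCount n b ≤ 2 ℕ.* length S
coveredCount≤2*cost {n} {b = b} {S} r-inj cert =
  ℕ.≤-trans (∑-mono-≤ {n} (λ v → 𝟙-mono (certificate-covers {v = v} r-inj (cheapPairs-loopless n b) cert)))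
            (∑-covers-≤ S)

coveredCount≤2*minCost : ∀ {n} {r : Fin n → ℕ} {b k} → Injective _≡_ _≡_ r →
                         IsMinCertCost r (cheapPairs n b) k → coveredCount n b ≤ 2 ℕ.* k
coveredCount≤2*minCost {n} {b = b} r-inj ((S , cert , |S|≡k) , _) =
  subst (λ k → coveredCount n b ≤ 2 ℕ.* k) |S|≡k (coveredCount≤2*cost r-inj cert)

expected-coveredCount : ∀ p n →
  𝔼 p (length (pairs n)) (ofℕ ∘ coveredCount n) ≡ ofℕ n * (1ℚ - pow (1ℚ - p) (n ∸ 1))
expected-coveredCount p n =
  weightedSum-∑ p (allBits (length (pairs n))) (λ v b → 𝟙 (covers (cheapPairs n b) v))
    (λ v → trans (𝔼-any-select p (incident v) (pairs n)) (cong (λ k → 1ℚ - pow (1ℚ - p) k) (count-incident-pairs v)))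

half-of-double : ∀ p m (X : List Bool → ℕ) → ½ * 𝔼 p m (λ b → ofℕ (2 ℕ.* X b)) ≡ 𝔼 p m (ofℕ ∘ X)
half-of-double p m X = begin
  ½ * 𝔼 p m (λ b → ofℕ (2 ℕ.* X b))         ≡⟨ cong (½ *_) (weightedSum-cong p (allBits m) (λ b → ofℕ-double (X b))) ⟩
  ½ * 𝔼 p m (λ b → ofℕ (X b) + ofℕ (X b))   ≡⟨ cong (½ *_) (weightedSum-+ p (allBits m) (ofℕ ∘ X) (ofℕ ∘ X)) ⟩
  ½ * (𝔼 p m (ofℕ ∘ X) + 𝔼 p m (ofℕ ∘ X))   ≡⟨ halve (𝔼 p m (ofℕ ∘ X)) ⟩
  𝔼 p m (ofℕ ∘ X)                           ∎
  where
  open ≡-Reasoning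
  ofℕ-double : ∀ k → ofℕ (2 ℕ.* k) ≡ ofℕ k + ofℕ k
  ofℕ-double k = trans (cong (λ l → ofℕ (k ℕ.+ l)) (ℕ.+-identityʳ k)) (ofℕ-+ k k)
  halve : ∀ x → ½ * (x + x) ≡ x
  halve = solve-∀ ℚ-ring

expected-minCost-bound : ∀ p → 0ℚ < p → p ≤ℚ 1ℚ → ∀ n (r : Fin n → ℕ) → Injective _≡_ _≡_ r →
  (opt : List Bool → ℕ) →
  ((b : List Bool) → b ∈ allBits (length (pairs n)) → IsMinCertCost r (cheapPairs n b) (opt b)) →
  ½ * ofℕ n * (1ℚ - pow (1ℚ - p) (n ∸ 1)) ≤ℚ expect n p opt
expected-minCost-bound p 0<p p≤1 n r r-inj opt opt-min = begin
  ½ * ofℕ n * X                              ≡⟨ *-assoc ½ (ofℕ n) X ⟩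
  ½ * (ofℕ n * X)                            ≡⟨ cong (½ *_) (expected-coveredCount p n) ⟨
  ½ * 𝔼 p m (ofℕ ∘ coveredCount n)           ≤⟨ *-monoˡ-≤-nonNeg ½ (weightedSum-mono p (<⇒≤ 0<p) p≤1 _ covered≤2opt) ⟩
  ½ * 𝔼 p m (λ b → ofℕ (2 ℕ.* opt b))        ≡⟨ half-of-double p m opt ⟩
  expect n p opt                             ∎
  where
  open ≤-Reasoning
  m : ℕ
  m = length (pairs n)
  X : ℚ
  X = 1ℚ - pow (1ℚ - p) (n ∸ 1)
  covered≤2opt : ∀ b → b ∈ allBits m → ofℕ (coveredCount n b) ≤ℚ ofℕ (2 ℕ.* opt b)
  covered≤2opt b b∈ = ofℕ-mono (coveredCount≤2*minCost r-inj (opt-min b b∈))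

mainTheorem12 : Σ ℚ λ c → 0ℚ < c × Σ ℕ λ n₀ →
    (p : ℚ) → 0ℚ < p → p ≤ℚ 1ℚ →
    (n : ℕ) → n₀ ≤ n →
    (r : Fin n → ℕ) → Injective _≡_ _≡_ r →
    (opt : List Bool → ℕ) →
    ((b : List Bool) → b ∈ allBits (length (pairs n)) → IsMinCertCost r (cheapPairs n b) (opt b)) →
    c * ofℕ n * (1ℚ - pow (1ℚ - p) (n ∸ 1)) ≤ℚ expect n p opt
mainTheorem12 = ½ , positive⁻¹ ½ , 0 , λ p 0<p p≤1 n _ → expected-minCost-bound p 0<p p≤1 n
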